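{- Let $G$ be a finite, simple, connected graph with $res(G)=k$. Then $\Delta(G)\leq 2^{k-1}+k-1$.
   Context: $d$ denotes graph distance and $\Delta(G)$ the maximum degree. For an ordered set $W=\{w_1,\dots,w_k\}\subseteq V(G)$ and $v\in V(G)$, $r(v|W)=(d(v,w_1),\dots,d(v,w_k))$. $W$ is a resolving set if distinct vertices of $G$ have distinct representations with respect to $W$. The resolving number $res(G)$ is the minimum $k$ such that every $k$-subset of $V(G)$ is a resolving set of $G$. -}

module Defs where

open import Data.Nat using (ℕ; zero; suc; _≤_)
open import Data.Fin using (Fin)
open import Data.Fin.Subset using (Subset; _∈_; ∣_∣)
open import Data.Vec using (tabulate)
open import Data.Product using (∃; _×_)
open import Relation.Nullary using (¬_; Dec; does)
open import Relation.Binary.PropositionalEquality using (_≡_)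

record SimpleGraph (n : ℕ) : Set₁ where
  field
    Adj   : Fin n → Fin n → Set
    adj?  : ∀ u v → Dec (Adj u v)
    sym   : ∀ {u v} → Adj u v → Adj v u
    irrefl : ∀ {u} → ¬ Adj u u

module _ {n : ℕ} (G : SimpleGraph n) where
  open SimpleGraph G

  data Walk : Fin n → Fin n → ℕ → Set where
    nil  : ∀ {u} → Walk u u 0
    cons : ∀ {u v w ℓ} → Adj u v → Walk v w ℓ → Walk u w (suc ℓ)

  Connected : Set
  Connected = ∀ u v → ∃ λ ℓ → Walk u v ℓ

  IsDist : Fin n → Fin n → ℕ → Set
  IsDist u v d = Walk u v d × (∀ m → Walk u v m → d ≤ m)

  neighbours : Fin n → Subset n
  neighbours v = tabulate (λ u → does (adj? v u))

  degree : Fin n → ℕ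
  degree v = ∣ neighbours v ∣

  Resolving : Subset n → Set
  Resolving W = ∀ u v →
    (∀ w → w ∈ W → ∀ a b → IsDist u w a → IsDist v w b → a ≡ b) → u ≡ v

  AllResolving : ℕ → Set
  AllResolving k = ∀ (W : Subset n) → ∣ W ∣ ≡ k → Resolving W

  HasResNumber : ℕ → Set
  HasResNumber k = AllResolving k × (∀ j → suc j ≤ k → ¬ AllResolving j)

module Submission where

-- Write k = m + 1 and suppose a vertex v has more than 2^m + m neighbours.
-- Choose a set T of m neighbours of v.  The remaining neighbours R = N(v) ∖ T
-- number more than 2^m, while a vertex has only 2^m possible adjacency
-- patterns towards T; by the pigeonhole principle two distinct x, y ∈ R have
-- the same neighbours in T.  Both are at distance 1 from v, and for w ∈ T the
-- path x – v – w shows that d(x,w) is 1 or 2 according to whether x ~ w; the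
-- same holds for y.  Hence the (m+1)-set T ∪ {v} does not separate x from y,
-- contradicting that every (m+1)-set resolves G.

open import Defs
open import Data.Nat using (ℕ; zero; suc; _≤_; _<_; _+_; _*_; _∸_; _^_; z≤n; s≤s; _<?_)
open import Data.Nat.Properties
  using ( +-suc; +-comm; +-identityʳ; +-mono-≤; +-monoˡ-≤; +-cancelˡ-<
        ; ≤-trans; ≤-reflexive; ≤-antisym; <⇒≤; ≤⇒≯; ≮⇒≥; m≤n+m; module ≤-Reasoning)
open import Data.Fin using (Fin; zero; suc)
open import Data.Fin.Properties using () renaming (suc-injective to fin-suc-injective)
open import Data.Fin.Subset
  using (Subset; inside; outside; _∈_; _∉_; _⊆_; ⊥; ⁅_⁆; _∪_; _∩_; _─_; ∣_∣; Nonempty)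
open import Data.Fin.Subset.Properties
  using ( ∉⊥; ⊥⊆; ∣⊥∣≡0; out⊆; in⊆in; ∪-identityʳ; x∈p∩q⁻; p─q⊆p
        ; x∈p∪q⁻; x∈⁅y⁆⇒x≡y; ∣p∩q∣≤∣q∣)
open import Data.Vec using ([]; _∷_; here; there)
open import Data.Vec.Properties using ([]=⇒lookup; lookup⇒[]=; lookup∘tabulate)
open import Data.Bool using (true)
open import Data.Product using (∃; ∃₂; _×_; _,_; proj₁; proj₂)
open import Data.Sum using (_⊎_; inj₁; inj₂)
open import Function using (_∘_; const)
open import Function.Bundles using (_⇔_; mk⇔; Equivalence)
open import Function.Construct.Composition using (_⇔-∘_)
open import Function.Construct.Symmetry using (⇔-sym)
open import Relation.Nullary using (¬_; Dec; yes; no; does; contradiction)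
open import Relation.Binary.PropositionalEquality using (_≡_; _≢_; refl; sym; trans; cong; subst)

∣p∩q∣+∣p─q∣≡∣p∣ : ∀ {n} (p q : Subset n) → ∣ p ∩ q ∣ + ∣ p ─ q ∣ ≡ ∣ p ∣
∣p∩q∣+∣p─q∣≡∣p∣ []            []            = refl
∣p∩q∣+∣p─q∣≡∣p∣ (inside  ∷ p) (inside  ∷ q) = cong suc (∣p∩q∣+∣p─q∣≡∣p∣ p q)
∣p∩q∣+∣p─q∣≡∣p∣ (inside  ∷ p) (outside ∷ q) =
  trans (+-suc ∣ p ∩ q ∣ ∣ p ─ q ∣) (cong suc (∣p∩q∣+∣p─q∣≡∣p∣ p q))
∣p∩q∣+∣p─q∣≡∣p∣ (outside ∷ p) (inside  ∷ q) = ∣p∩q∣+∣p─q∣≡∣p∣ p q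
∣p∩q∣+∣p─q∣≡∣p∣ (outside ∷ p) (outside ∷ q) = ∣p∩q∣+∣p─q∣≡∣p∣ p q

∣p∪⁅x⁆∣≡1+∣p∣ : ∀ {n} (p : Subset n) (x : Fin n) → x ∉ p → ∣ p ∪ ⁅ x ⁆ ∣ ≡ suc ∣ p ∣
∣p∪⁅x⁆∣≡1+∣p∣ (outside ∷ p) zero    _   = cong (suc ∘ ∣_∣) (∪-identityʳ p)
∣p∪⁅x⁆∣≡1+∣p∣ (inside  ∷ p) zero    x∉p = contradiction here x∉p
∣p∪⁅x⁆∣≡1+∣p∣ (outside ∷ p) (suc x) x∉p = ∣p∪⁅x⁆∣≡1+∣p∣ p x (x∉p ∘ there)
∣p∪⁅x⁆∣≡1+∣p∣ (inside  ∷ p) (suc x) x∉p = cong suc (∣p∪⁅x⁆∣≡1+∣p∣ p x (x∉p ∘ there))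

x∈p─q⇒x∉q : ∀ {n} (p q : Subset n) {x : Fin n} → x ∈ p ─ q → x ∉ q
x∈p─q⇒x∉q (s ∷ p) (outside ∷ q) here       ()
x∈p─q⇒x∉q (s ∷ p) (t ∷ q)       (there x∈) (there x∈q) = x∈p─q⇒x∉q p q x∈ x∈q

chooseSubset : ∀ {n} m (p : Subset n) → m ≤ ∣ p ∣ → ∃ λ q → q ⊆ p × ∣ q ∣ ≡ m
chooseSubset {n} zero p _ = ⊥ , ⊥⊆ , ∣⊥∣≡0 n
chooseSubset (suc m) (inside ∷ p) (s≤s m≤∣p∣) with chooseSubset m p m≤∣p∣
... | q , q⊆p , ∣q∣≡m = inside ∷ q , in⊆in q⊆p , cong suc ∣q∣≡m
chooseSubset (suc m) (outside ∷ p) m<∣p∣ with chooseSubset (suc m) p m<∣p∣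
... | q , q⊆p , ∣q∣≡m = outside ∷ q , out⊆ q⊆p , ∣q∣≡m

nonempty : ∀ {n} (p : Subset n) → 0 < ∣ p ∣ → Nonempty p
nonempty (inside  ∷ p) _   = zero , here
nonempty (outside ∷ p) 0<∣p∣ with nonempty p 0<∣p∣
... | x , x∈p = suc x , there x∈p

twoDistinct : ∀ {n} (p : Subset n) → 1 < ∣ p ∣ → ∃₂ λ x y → x ∈ p × y ∈ p × x ≢ y
twoDistinct (inside ∷ p) (s≤s 0<∣p∣) with nonempty p 0<∣p∣
... | y , y∈p = zero , suc y , here , there y∈p , λ ()
twoDistinct (outside ∷ p) 1<∣p∣ with twoDistinct p 1<∣p∣
... | x , y , x∈p , y∈p , x≢y = suc x , suc y , there x∈p , there y∈p , x≢y ∘ fin-suc-injective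

oneSummandLarge : ∀ a b c → 2 * a < b + c → a < b ⊎ a < c
oneSummandLarge a b c 2a<b+c with a <? b | a <? c
... | yes a<b | _       = inj₁ a<b
... | no _    | yes a<c = inj₂ a<c
... | no a≮b  | no a≮c  = contradiction 2a<b+c (≤⇒≯ b+c≤2a)
  where
  open ≤-Reasoning
  b+c≤2a : b + c ≤ 2 * a
  b+c≤2a = begin
    b + c       ≤⟨ +-mono-≤ (≮⇒≥ a≮b) (≮⇒≥ a≮c) ⟩
    a + a       ≡⟨ cong (a +_) (sym (+-identityʳ a)) ⟩
    2 * a       ∎

record Twins {k n} (t : Fin k → Subset n) (T : Subset k) (R : Subset n) : Set where
  constructor twins
  field
    x y   : Fin n
    x∈R   : x ∈ R
    y∈R   : y ∈ R
    x≢y   : x ≢ y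
    agree : ∀ {i} → i ∈ T → (x ∈ t i ⇔ y ∈ t i)

skipTest : ∀ {k n} {t : Fin (suc k) → Subset n} {T R} → Twins (t ∘ suc) T R → Twins t (outside ∷ T) R
skipTest (twins x y x∈R y∈R x≢y agree) =
  twins x y x∈R y∈R x≢y λ { {suc i} (there i∈T) → agree i∈T }

refineByTest : ∀ {k n} {t : Fin (suc k) → Subset n} {T R R′} → R′ ⊆ R →
  (∀ {x y} → x ∈ R′ → y ∈ R′ → (x ∈ t zero ⇔ y ∈ t zero)) →
  Twins (t ∘ suc) T R′ → Twins t (inside ∷ T) R
refineByTest R′⊆R constant (twins x y x∈R′ y∈R′ x≢y agree) =
  twins x y (R′⊆R x∈R′) (R′⊆R y∈R′) x≢y
    λ { {zero} here → constant x∈R′ y∈R′ ; {suc i} (there i∈T) → agree i∈T }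

pigeonhole : ∀ {k n} (t : Fin k → Subset n) (T : Subset k) (R : Subset n) →
  2 ^ ∣ T ∣ < ∣ R ∣ → Twins t T R
pigeonhole t [] R 1<∣R∣ with twoDistinct R 1<∣R∣
... | x , y , x∈R , y∈R , x≢y = twins x y x∈R y∈R x≢y λ ()
pigeonhole t (outside ∷ T) R large = skipTest (pigeonhole (t ∘ suc) T R large)
pigeonhole t (inside ∷ T) R large
  with oneSummandLarge (2 ^ ∣ T ∣) ∣ R ∩ t zero ∣ ∣ R ─ t zero ∣
         (subst (2 ^ suc ∣ T ∣ <_) (sym (∣p∩q∣+∣p─q∣≡∣p∣ R (t zero))) large)
... | inj₁ largeIn  = refineByTest (λ {x} → proj₁ ∘ x∈p∩q⁻ R (t zero)) bothIn
                        (pigeonhole (t ∘ suc) T (R ∩ t zero) largeIn)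
  where
  bothIn : ∀ {x y} → x ∈ R ∩ t zero → y ∈ R ∩ t zero → (x ∈ t zero ⇔ y ∈ t zero)
  bothIn x∈ y∈ = mk⇔ (const (proj₂ (x∈p∩q⁻ R (t zero) y∈))) (const (proj₂ (x∈p∩q⁻ R (t zero) x∈)))
... | inj₂ largeOut = refineByTest (p─q⊆p R (t zero)) bothOut
                        (pigeonhole (t ∘ suc) T (R ─ t zero) largeOut)
  where
  bothOut : ∀ {x y} → x ∈ R ─ t zero → y ∈ R ─ t zero → (x ∈ t zero ⇔ y ∈ t zero)
  bothOut x∈ y∈ = mk⇔ (λ x∈A → contradiction x∈A (x∈p─q⇒x∉q R (t zero) x∈))
                      (λ y∈A → contradiction y∈A (x∈p─q⇒x∉q R (t zero) y∈))

module _ {n : ℕ} (G : SimpleGraph n) where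
  open SimpleGraph G renaming (sym to adj-sym)

  ∈neighbours⇔ : ∀ {u v} → u ∈ neighbours G v ⇔ Adj v u
  ∈neighbours⇔ {u} {v} = does⇔ (adj? v u) ⇔-∘ lookup⇔
    where
    lookup⇔ : u ∈ neighbours G v ⇔ does (adj? v u) ≡ true
    lookup⇔ = mk⇔ (λ u∈ → trans (sym (lookup∘tabulate _ u)) ([]=⇒lookup u∈))
                  (λ e → lookup⇒[]= u _ (trans (lookup∘tabulate _ u) e))
    does⇔ : ∀ {P : Set} (P? : Dec P) → does P? ≡ true ⇔ P
    does⇔ (yes p) = mk⇔ (const p) (const refl)
    does⇔ (no ¬p) = mk⇔ (λ ()) (λ p → contradiction p ¬p)

  ∈neighbours⇒Adj : ∀ {u v} → u ∈ neighbours G v → Adj v u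
  ∈neighbours⇒Adj = Equivalence.to ∈neighbours⇔

  IsDist-unique : ∀ {x w a b} → IsDist G x w a → IsDist G x w b → a ≡ b
  IsDist-unique (walkA , shortestA) (walkB , shortestB) =
    ≤-antisym (shortestA _ walkB) (shortestB _ walkA)

  emptyWalk : ∀ {x w} → Walk G x w 0 → x ≡ w
  emptyWalk nil = refl

  adjacent⇒distance1 : ∀ {x w} → Adj x w → IsDist G x w 1
  adjacent⇒distance1 {x} {w} x~w = cons x~w nil , atLeast1
    where
    atLeast1 : ∀ m → Walk G x w m → 1 ≤ m
    atLeast1 zero    walk with emptyWalk walk
    ... | refl = contradiction x~w irrefl
    atLeast1 (suc m) _    = s≤s z≤n

  commonNeighbour⇒distance2 : ∀ {x v w} → x ≢ w → ¬ Adj x w → Adj x v → Adj v w →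
    IsDist G x w 2
  commonNeighbour⇒distance2 {x} {v} {w} x≢w x≁w x~v v~w = cons x~v (cons v~w nil) , atLeast2
    where
    atLeast2 : ∀ m → Walk G x w m → 2 ≤ m
    atLeast2 zero          walk            = contradiction (emptyWalk walk) x≢w
    atLeast2 (suc zero)    (cons x~w′ nil) = contradiction x~w′ x≁w
    atLeast2 (suc (suc m)) _               = s≤s (s≤s z≤n)

  equalDistances : ∀ {v x y w} → Adj v x → Adj v y → Adj v w → x ≢ w → y ≢ w →
    (Adj w x ⇔ Adj w y) → ∀ a b → IsDist G x w a → IsDist G y w b → a ≡ b
  equalDistances {x = x} {y} {w} v~x v~y v~w x≢w y≢w sameAdj a b dx dy with adj? w x
  ... | yes w~x = trans (IsDist-unique dx (adjacent⇒distance1 (adj-sym w~x)))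
                        (IsDist-unique (adjacent⇒distance1 (adj-sym (Equivalence.to sameAdj w~x))) dy)
  ... | no w≁x  = trans (IsDist-unique dx (commonNeighbour⇒distance2 x≢w (w≁x ∘ adj-sym) (adj-sym v~x) v~w))
                        (IsDist-unique (commonNeighbour⇒distance2 y≢w (w≁y ∘ adj-sym) (adj-sym v~y) v~w) dy)
    where
    w≁y : ¬ Adj w y
    w≁y = w≁x ∘ Equivalence.from sameAdj

  Unseparated : Subset n → Fin n → Fin n → Set
  Unseparated W x y = ∀ w → w ∈ W → ∀ a b → IsDist G x w a → IsDist G y w b → a ≡ b

  -- With two or more vertices the empty set separates nothing, so res(G) ≥ 1.
  notAllResolving0 : 2 ≤ n → ¬ AllResolving G 0
  notAllResolving0 (s≤s (s≤s _)) allResolve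
    with allResolve ⊥ (∣⊥∣≡0 n) zero (suc zero) (λ w w∈⊥ → contradiction w∈⊥ ∉⊥)
  ... | ()

  twinNeighboursUnseparated : ∀ {v x y} (T : Subset n) → T ⊆ neighbours G v →
    Adj v x → Adj v y → x ∉ T → y ∉ T → (∀ {w} → w ∈ T → (Adj w x ⇔ Adj w y)) →
    Unseparated (T ∪ ⁅ v ⁆) x y
  twinNeighboursUnseparated {v} T T⊆N v~x v~y x∉T y∉T sameAdj w w∈W
    with x∈p∪q⁻ T ⁅ v ⁆ w∈W
  ... | inj₁ w∈T = equalDistances v~x v~y (∈neighbours⇒Adj (T⊆N w∈T))
                     (λ { refl → x∉T w∈T }) (λ { refl → y∉T w∈T }) (sameAdj w∈T)
  ... | inj₂ w∈⁅v⁆ rewrite x∈⁅y⁆⇒x≡y v w∈⁅v⁆ = λ a b dx dy →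
    trans (IsDist-unique dx (adjacent⇒distance1 (adj-sym v~x)))
          (IsDist-unique (adjacent⇒distance1 (adj-sym v~y)) dy)

  degreeBound : ∀ m v → AllResolving G (suc m) → degree G v ≤ 2 ^ m + m
  degreeBound m v allResolve = ≮⇒≥ notTooManyNeighbours
    where
    N : Subset n
    N = neighbours G v
    notTooManyNeighbours : ¬ (2 ^ m + m < ∣ N ∣)
    notTooManyNeighbours large with chooseSubset m N (≤-trans (m≤n+m m (2 ^ m)) (<⇒≤ large))
    ... | T , T⊆N , ∣T∣≡m = x≢y (allResolve (T ∪ ⁅ v ⁆) ∣T∪v∣≡1+m x y unseparated)
      where
      R : Subset n
      R = N ─ T
      open ≤-Reasoning
      largeR : 2 ^ ∣ T ∣ < ∣ R ∣
      largeR rewrite ∣T∣≡m = +-cancelˡ-< m (2 ^ m) ∣ R ∣ (begin-strict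
        m + 2 ^ m        ≡⟨ +-comm m (2 ^ m) ⟩
        2 ^ m + m        <⟨ large ⟩
        ∣ N ∣             ≡⟨ sym (∣p∩q∣+∣p─q∣≡∣p∣ N T) ⟩
        ∣ N ∩ T ∣ + ∣ R ∣ ≤⟨ +-monoˡ-≤ ∣ R ∣ (≤-trans (∣p∩q∣≤∣q∣ N T) (≤-reflexive ∣T∣≡m)) ⟩
        m + ∣ R ∣         ∎)
      open Twins (pigeonhole (neighbours G) T R largeR)
      v∉T : v ∉ T
      v∉T v∈T = irrefl (∈neighbours⇒Adj (T⊆N v∈T))
      ∣T∪v∣≡1+m : ∣ T ∪ ⁅ v ⁆ ∣ ≡ suc m
      ∣T∪v∣≡1+m = trans (∣p∪⁅x⁆∣≡1+∣p∣ T v v∉T) (cong suc ∣T∣≡m)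
      unseparated : Unseparated (T ∪ ⁅ v ⁆) x y
      unseparated = twinNeighboursUnseparated T T⊆N
        (∈neighbours⇒Adj (p─q⊆p N T x∈R)) (∈neighbours⇒Adj (p─q⊆p N T y∈R))
        (x∈p─q⇒x∉q N T x∈R) (x∈p─q⇒x∉q N T y∈R)
        (λ w∈T → (∈neighbours⇔ ⇔-∘ agree w∈T) ⇔-∘ ⇔-sym ∈neighbours⇔)

-- Main theorem.  The case k = 0 is impossible for n ≥ 2; for k = m + 1 the
-- bound 2^(k-1) + k - 1 is 2^m + m.
mainTheorem10 : ∀ (n : ℕ) (G : SimpleGraph n) → 2 ≤ n → Connected G → ∀ (k : ℕ) →
                  HasResNumber G k → ∀ (v : Fin n) → degree G v ≤ 2 ^ (k ∸ 1) + k ∸ 1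
mainTheorem10 n G 2≤n _ zero    (allResolve , _) v = contradiction allResolve (notAllResolving0 G 2≤n)
mainTheorem10 n G _   _ (suc m) (allResolve , _) v =
  subst (degree G v ≤_) (cong (_∸ 1) (sym (+-suc (2 ^ m) m))) (degreeBound G m v allResolve)
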